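{- There exist $3$-graphs $F$ that are $\mathcal Q^{+2}_5$-colorable but not $\mathcal Q'^-_3$-colorable, where $\mathcal Q^{+2}_5=([5],\{(1,2,3),(4,1,5)\})$ and $\mathcal Q'^-_3=([3],\{(1,3,1),(1,3,2),(2,3,1),(2,3,2)\})$.
   Context: A palette $(\mathcal C,\mathcal A)$ is a finite color set $\mathcal C$ with admissible ordered triples $\mathcal A\subseteq\mathcal C^3$. A $3$-graph $F$ is $(\mathcal C,\mathcal A)$-colorable if there exist a linear order $\prec$ on $V(F)$ and a map $\varphi$ from the pairs of vertices contained in edges of $F$ to $\mathcal C$ with $(\varphi(uv),\varphi(uw),\varphi(vw))\in\mathcal A$ for every edge $\{u,v,w\}$, $u\prec v\prec w$. -}

module Defs where

open import Data.Nat using (ℕ; suc)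
open import Data.Fin using (Fin; zero; suc; _<_)
open import Data.List using (List)
open import Data.List.Membership.Propositional using (_∈_)
open import Data.Product using (_×_; _,_; ∃)
open import Data.Sum using (_⊎_)
open import Relation.Binary.PropositionalEquality using (_≡_; _≢_)
open import Function.Bundles using (Bijection)
open import Data.Fin.Base using (toℕ)
open import Level using (0ℓ)

record Palette : Set₁ where
  field
    k   : ℕ
    adm : Fin k → Fin k → Fin k → Set
open Palette public

-- A (finite) 3-graph on vertex set Fin n: edges are listed as triples of
-- pairwise distinct vertices; a triple stands for the 3-set of its entries.
record ThreeGraph : Set where
  field
    n     : ℕ
    edges : List (Fin n × Fin n × Fin n)
    distinct : ∀ {a b c} → (a , b , c) ∈ edges → (a ≢ b) × (a ≢ c) × (b ≢ c)
open ThreeGraph public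

IsEdge : (F : ThreeGraph) → Fin (n F) → Fin (n F) → Fin (n F) → Set
IsEdge F u v w =
  ((u , v , w) ∈ edges F) ⊎ ((u , w , v) ∈ edges F) ⊎ ((v , u , w) ∈ edges F) ⊎
  ((v , w , u) ∈ edges F) ⊎ ((w , u , v) ∈ edges F) ⊎ ((w , v , u) ∈ edges F)

-- F is (C,A)-colourable: there is a linear order ≺ on V(F), given as a
-- bijection rank : Fin n → Fin n (u ≺ v iff rank u < rank v), and a colouring
-- φ of (unordered) pairs of vertices with (φ(uv),φ(uw),φ(vw)) ∈ A for every
-- edge {u,v,w} with u ≺ v ≺ w.  (φ is defined on all pairs; pairs not in an
-- edge are irrelevant, and any colouring of the pairs in edges extends.)
Colorable : Palette → ThreeGraph → Set
Colorable P F =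
  ∃ λ (rank : Bijection (≡-setoid (Fin (n F))) (≡-setoid (Fin (n F)))) →
  ∃ λ (φ : Fin (n F) → Fin (n F) → Fin (k P)) →
    (∀ u v → φ u v ≡ φ v u) ×
    (∀ u v w → IsEdge F u v w →
       Bijection.to rank u < Bijection.to rank v →
       Bijection.to rank v < Bijection.to rank w →
       adm P (φ u v) (φ u w) (φ v w))
  where open import Relation.Binary.PropositionalEquality using () renaming (setoid to ≡-setoid)

-- Colours are 1..k in the paper; Fin k colour i stands for paper colour i+1.
c1 c2 c3 c4 c5 : Fin 5
c1 = zero
c2 = suc zero
c3 = suc (suc zero)
c4 = suc (suc (suc zero))
c5 = suc (suc (suc (suc zero)))

data Q5adm : Fin 5 → Fin 5 → Fin 5 → Set where
  t123 : Q5adm c1 c2 c3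
  t415 : Q5adm c4 c1 c5

Q5+2 : Palette
Q5+2 = record { k = 5 ; adm = Q5adm }

d1 d2 d3 : Fin 3
d1 = zero
d2 = suc zero
d3 = suc (suc zero)

data Q3adm : Fin 3 → Fin 3 → Fin 3 → Set where
  t131 : Q3adm d1 d3 d1
  t132 : Q3adm d1 d3 d2
  t231 : Q3adm d2 d3 d1
  t232 : Q3adm d2 d3 d2

Q3'- : Palette
Q3'- = record { k = 3 ; adm = Q3adm }

-- In a Q'^-_3-colouring every edge u ≺ v ≺ w has colour 3 on its outer pair uw and colours 1, 2 on its
-- inner pairs uv and vw, so no pair can be the outer pair of one edge and an inner pair of another.
-- In Q^{+2}_5 the colour 1 plays both roles, and this lets the ten-vertex graph F₀ be coloured in its
-- natural vertex order. Yet every linear order of V(F₀) makes some pair outer in one edge and inner in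
-- another: a computer-generated case analysis on comparisons of vertices reaches such a clash in every
-- branch.

module Submission where

open import Data.Empty using (⊥; ⊥-elim)
open import Data.Fin using (Fin; _<_; _≟_; #_)
open import Data.Fin.Properties using (<-asym; <-trans; <-cmp; <⇒≢; _<?_; all?)
open import Data.List using (List; []; _∷_)
import Data.List.Membership.DecPropositional as DecMembership
open import Data.List.Membership.Propositional using (_∈_)
open import Data.List.Relation.Unary.All as All using (All; []; _∷_)
open import Data.List.Relation.Unary.Any using (Any; any?)
open import Data.Nat using (ℕ; zero; suc)
open import Data.Product using (∃; _×_; _,_; proj₁; proj₂)
open import Data.Product.Properties using (≡-dec)
open import Data.Sum using (_⊎_; inj₁; inj₂)
open import Data.Vec using (Vec; []; _∷_; lookup)
open import Function.Bundles using (Bijection)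
open import Function.Construct.Identity using (bijection)
open import Relation.Binary.Definitions using (tri<; tri≈; tri>)
open import Relation.Binary.PropositionalEquality using (_≡_; _≢_; refl; sym; trans; setoid)
open import Relation.Nullary using (¬_; Dec; no)
open import Relation.Nullary.Decidable using (_×-dec_; _⊎-dec_; ¬?; from-yes)

open import Defs

Triple : ℕ → Set
Triple m = Fin m × Fin m × Fin m

isEdge? : (F : ThreeGraph) → ∀ u v w → Dec (IsEdge F u v w)
isEdge? F u v w =
  listed (u , v , w) ⊎-dec listed (u , w , v) ⊎-dec listed (v , u , w) ⊎-dec
  listed (v , w , u) ⊎-dec listed (w , u , v) ⊎-dec listed (w , v , u)
  where
  open DecMembership (≡-dec _≟_ (≡-dec _≟_ _≟_)) using (_∈?_)
  listed : ∀ t → Dec (t ∈ edges F)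
  listed t = t ∈? edges F

Increasing : ∀ {m} → Triple m → Set
Increasing (a , b , c) = a < b × b < c

increasing⇒distinct : ∀ {m} {a b c : Fin m} → Increasing (a , b , c) → a ≢ b × a ≢ c × b ≢ c
increasing⇒distinct (a<b , b<c) = <⇒≢ a<b , <⇒≢ (<-trans a<b b<c) , <⇒≢ b<c

IsEdge⇒∈ : ∀ F → All Increasing (edges F) →
           ∀ {u v w} → IsEdge F u v w → u < v → v < w → (u , v , w) ∈ edges F
IsEdge⇒∈ F inc (inj₁ uvw) _ _ = uvw
IsEdge⇒∈ F inc (inj₂ (inj₁ uwv)) u<v v<w =
  ⊥-elim (<-asym v<w (proj₂ (All.lookup inc uwv)))
IsEdge⇒∈ F inc (inj₂ (inj₂ (inj₁ vuw))) u<v v<w =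
  ⊥-elim (<-asym u<v (proj₁ (All.lookup inc vuw)))
IsEdge⇒∈ F inc (inj₂ (inj₂ (inj₂ (inj₁ vwu)))) u<v v<w =
  ⊥-elim (<-asym u<v (<-trans v<w (proj₂ (All.lookup inc vwu))))
IsEdge⇒∈ F inc (inj₂ (inj₂ (inj₂ (inj₂ (inj₁ wuv))))) u<v v<w =
  ⊥-elim (<-asym (<-trans u<v v<w) (proj₁ (All.lookup inc wuv)))
IsEdge⇒∈ F inc (inj₂ (inj₂ (inj₂ (inj₂ (inj₂ wvu))))) u<v v<w =
  ⊥-elim (<-asym v<w (proj₁ (All.lookup inc wvu)))

colorable-in-vertex-order :
  ∀ P F → All Increasing (edges F) →
  (φ : Fin (n F) → Fin (n F) → Fin (k P)) → (∀ u v → φ u v ≡ φ v u) →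
  All (λ (a , b , c) → adm P (φ a b) (φ a c) (φ b c)) (edges F) →
  Colorable P F
colorable-in-vertex-order P F increasing φ φ-sym admissible =
  bijection (setoid _) , φ , φ-sym ,
  λ u v w edge u<v v<w → All.lookup admissible (IsEdge⇒∈ F increasing edge u<v v<w)

OuterSeparated : Palette → Set
OuterSeparated P = ∀ {a b c a′ b′ c′} → adm P a b c → adm P a′ b′ c′ → b ≢ a′ × b ≢ c′

Q3-outer≡d3 : ∀ {a b c} → Q3adm a b c → b ≡ d3
Q3-outer≡d3 t131 = refl
Q3-outer≡d3 t132 = refl
Q3-outer≡d3 t231 = refl
Q3-outer≡d3 t232 = refl

Q3-inner≢d3 : ∀ {a b c} → Q3adm a b c → a ≢ d3 × c ≢ d3
Q3-inner≢d3 t131 = (λ ()) , (λ ())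
Q3-inner≢d3 t132 = (λ ()) , (λ ())
Q3-inner≢d3 t231 = (λ ()) , (λ ())
Q3-inner≢d3 t232 = (λ ()) , (λ ())

Q3'-outerSeparated : OuterSeparated Q3'-
Q3'-outerSeparated t t′ =
  (λ b≡a′ → proj₁ (Q3-inner≢d3 t′) (trans (sym b≡a′) (Q3-outer≡d3 t))) ,
  (λ b≡c′ → proj₂ (Q3-inner≢d3 t′) (trans (sym b≡c′) (Q3-outer≡d3 t)))

module _ (F : ThreeGraph) where

  private
    V : Set
    V = Fin (n F)

  Facts : Set
  Facts = List (V × V)

  Chain : ℕ → Facts → V → V → Set
  Chain zero    fs x y = ⊥
  Chain (suc k) fs x y = Any (λ (a , b) → a ≡ x × (b ≡ y ⊎ Chain k fs b y)) fs

  chain? : ∀ k fs x y → Dec (Chain k fs x y)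
  chain? zero    fs x y = no λ ()
  chain? (suc k) fs x y = any? (λ (a , b) → (a ≟ x) ×-dec ((b ≟ y) ⊎-dec chain? k fs b y)) fs

  -- A consistent set of facts is acyclic, so chains of n F facts are long enough.
  Precedes : Facts → V → V → Set
  Precedes = Chain (n F)

  Oriented : Facts → V → V → V → Set
  Oriented fs a b c = IsEdge F a b c × Precedes fs a b × Precedes fs b c

  oriented? : ∀ fs a b c → Dec (Oriented fs a b c)
  oriented? fs a b c = isEdge? F a b c ×-dec chain? (n F) fs a b ×-dec chain? (n F) fs b c

  data Refutation : Set where
    split : V → V → Refutation → Refutation → Refutation
    clashˡ clashʳ : V → V → V → V → Refutation

  Refutes : Facts → Refutation → Set
  Refutes fs (split x y l r)  = x ≢ y × Refutes ((x , y) ∷ fs) l × Refutes ((y , x) ∷ fs) r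
  Refutes fs (clashˡ a b c d) = Oriented fs a b c × Oriented fs a c d
  Refutes fs (clashʳ a b c d) = Oriented fs a b c × Oriented fs d a c

  refutes? : ∀ fs R → Dec (Refutes fs R)
  refutes? fs (split x y l r) =
    ¬? (x ≟ y) ×-dec refutes? ((x , y) ∷ fs) l ×-dec refutes? ((y , x) ∷ fs) r
  refutes? fs (clashˡ a b c d) = oriented? fs a b c ×-dec oriented? fs a c d
  refutes? fs (clashʳ a b c d) = oriented? fs a b c ×-dec oriented? fs d a c

module _ {P : Palette} (separated : OuterSeparated P) {F : ThreeGraph} where

  refutation-sound : (R : Refutation F) → Refutes F [] R → ¬ Colorable P F
  refutation-sound R refutes (rank , φ , _ , admissible) = refutes-sound R [] refutes
    where
    position : Fin (n F) → Fin (n F)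
    position = Bijection.to rank

    Respected : Facts F → Set
    Respected = All (λ (x , y) → position x < position y)

    chain-sound : ∀ {fs x y} k → Respected fs → Chain F k fs x y → position x < position y
    chain-sound {fs} {x} {y} (suc k) respected chain =
      All.lookupWith {R = λ _ → position x < position y} link respected chain
      where
      link : ∀ {ab} → position (proj₁ ab) < position (proj₂ ab) →
             proj₁ ab ≡ x × (proj₂ ab ≡ y ⊎ Chain F k fs (proj₂ ab) y) → position x < position y
      link x<b (refl , inj₁ refl) = x<b
      link x<b (refl , inj₂ rest) = <-trans x<b (chain-sound k respected rest)

    oriented-admissible : ∀ {fs a b c} → Respected fs → Oriented F fs a b c →
                          adm P (φ a b) (φ a c) (φ b c)
    oriented-admissible respected (edge , a≺b , b≺c) =
      admissible _ _ _ edge (chain-sound _ respected a≺b) (chain-sound _ respected b≺c)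

    refutes-sound : ∀ R {fs} → Respected fs → Refutes F fs R → ⊥
    refutes-sound (split x y l r) respected (x≢y , refutesˡ , refutesʳ)
      with <-cmp (position x) (position y)
    ... | tri< x<y _ _ = refutes-sound l (x<y ∷ respected) refutesˡ
    ... | tri≈ _ x≡y _ = x≢y (Bijection.injective rank x≡y)
    ... | tri> _ _ y<x = refutes-sound r (y<x ∷ respected) refutesʳ
    refutes-sound (clashˡ a b c d) respected (abc , acd) =
      proj₁ (separated (oriented-admissible respected abc) (oriented-admissible respected acd)) refl
    refutes-sound (clashʳ a b c d) respected (abc , dac) =
      proj₂ (separated (oriented-admissible respected abc) (oriented-admissible respected dac)) refl

v0 v1 v2 v3 v4 v5 v6 v7 v8 v9 : Fin 10
v0 = # 0
v1 = # 1
v2 = # 2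
v3 = # 3
v4 = # 4
v5 = # 5
v6 = # 6
v7 = # 7
v8 = # 8
v9 = # 9

edges₀ : List (Triple 10)
edges₀ =
  (v0 , v1 , v3) ∷ (v0 , v2 , v9) ∷ (v0 , v3 , v8) ∷ (v0 , v4 , v7) ∷ (v0 , v4 , v9) ∷
  (v0 , v7 , v8) ∷ (v1 , v2 , v9) ∷ (v1 , v4 , v6) ∷ (v1 , v4 , v8) ∷ (v1 , v4 , v9) ∷
  (v1 , v5 , v6) ∷ (v1 , v7 , v9) ∷ (v2 , v3 , v6) ∷ (v2 , v3 , v7) ∷ (v2 , v4 , v6) ∷
  (v2 , v5 , v8) ∷ (v2 , v7 , v8) ∷ (v3 , v4 , v9) ∷ (v6 , v7 , v9) ∷ (v6 , v8 , v9) ∷ []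

edges₀-increasing : All Increasing edges₀
edges₀-increasing = from-yes (All.all? (λ (a , b , c) → a <? b ×-dec b <? c) edges₀)

F₀ : ThreeGraph
F₀ = record
  { n        = 10
  ; edges    = edges₀
  ; distinct = λ edge → increasing⇒distinct (All.lookup edges₀-increasing edge)
  }

colouring₀ : Vec (Vec (Fin 5) 10) 10
colouring₀ =
  (c1 ∷ c4 ∷ c4 ∷ c1 ∷ c4 ∷ c1 ∷ c1 ∷ c1 ∷ c2 ∷ c1 ∷ []) ∷
  (c4 ∷ c1 ∷ c4 ∷ c5 ∷ c4 ∷ c4 ∷ c1 ∷ c4 ∷ c1 ∷ c1 ∷ []) ∷
  (c4 ∷ c4 ∷ c1 ∷ c4 ∷ c4 ∷ c1 ∷ c1 ∷ c1 ∷ c2 ∷ c5 ∷ []) ∷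
  (c1 ∷ c5 ∷ c4 ∷ c1 ∷ c4 ∷ c1 ∷ c5 ∷ c5 ∷ c3 ∷ c1 ∷ []) ∷
  (c4 ∷ c4 ∷ c4 ∷ c4 ∷ c1 ∷ c1 ∷ c5 ∷ c5 ∷ c5 ∷ c5 ∷ []) ∷
  (c1 ∷ c4 ∷ c1 ∷ c1 ∷ c1 ∷ c1 ∷ c5 ∷ c1 ∷ c3 ∷ c1 ∷ []) ∷
  (c1 ∷ c1 ∷ c1 ∷ c5 ∷ c5 ∷ c5 ∷ c1 ∷ c4 ∷ c4 ∷ c1 ∷ []) ∷
  (c1 ∷ c4 ∷ c1 ∷ c5 ∷ c5 ∷ c1 ∷ c4 ∷ c1 ∷ c3 ∷ c5 ∷ []) ∷
  (c2 ∷ c1 ∷ c2 ∷ c3 ∷ c5 ∷ c3 ∷ c4 ∷ c3 ∷ c1 ∷ c5 ∷ []) ∷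
  (c1 ∷ c1 ∷ c5 ∷ c1 ∷ c5 ∷ c1 ∷ c1 ∷ c5 ∷ c5 ∷ c1 ∷ []) ∷ []

φ₀ : Fin 10 → Fin 10 → Fin 5
φ₀ u v = lookup (lookup colouring₀ u) v

φ₀-sym : ∀ u v → φ₀ u v ≡ φ₀ v u
φ₀-sym = from-yes (all? λ u → all? λ v → φ₀ u v ≟ φ₀ v u)

F₀-Q5-colorable : Colorable Q5+2 F₀
F₀-Q5-colorable = colorable-in-vertex-order Q5+2 F₀ edges₀-increasing φ₀ φ₀-sym
  (t415 ∷ t415 ∷ t123 ∷ t415 ∷ t415 ∷ t123 ∷ t415 ∷ t415 ∷ t415 ∷ t415 ∷
   t415 ∷ t415 ∷ t415 ∷ t415 ∷ t415 ∷ t123 ∷ t123 ∷ t415 ∷ t415 ∷ t415 ∷ [])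

F₀-refutation : Refutation F₀
F₀-refutation =
  split v4 v9 (split v1 v9 (split v1 v4 (split v0 v9 (split v0 v4 (split v2 v9 (split v0 v2
  (split v1 v2 (split v0 v7 (split v4 v7 (split v7 v9 (split v0 v8 (split v7 v8
  (clashˡ v0 v4 v7 v8) (split v6 v9 (split v6 v7 (split v6 v8 (split v0 v3 (split v3 v8
  (clashˡ v0 v3 v8 v7) (split v1 v6 (split v4 v6 (split v0 v1 (split v3 v9 (clashʳ v4 v3 v9 v0)
  (split v2 v6 (clashˡ v2 v8 v7 v3) (split v2 v7 (clashʳ v2 v7 v3 v6) (split v1 v5 (split v5 v6
  (clashʳ v8 v7 v2 v5) (clashˡ v1 v4 v6 v5)) (clashʳ v1 v4 v6 v5))))) (clashʳ v0 v8 v3 v1))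
  (clashˡ v1 v6 v4 v9)) (split v2 v3 (split v0 v1 (split v2 v4 (split v2 v8 (split v4 v8
  (split v3 v7 (clashʳ v4 v3 v9 v0) (clashʳ v2 v7 v3 v6)) (clashʳ v1 v8 v4 v6))
  (clashʳ v8 v2 v7 v0)) (clashˡ v6 v4 v2 v3)) (clashʳ v0 v8 v3 v1)) (split v2 v7
  (clashʳ v8 v2 v7 v0) (clashˡ v6 v1 v4 v2))))) (split v2 v7 (split v2 v8 (clashʳ v2 v8 v7 v3)
  (clashʳ v8 v2 v7 v0)) (split v4 v6 (split v0 v1 (split v1 v5 (split v5 v6 (clashʳ v8 v7 v2 v5)
  (clashˡ v1 v4 v6 v5)) (clashʳ v1 v4 v6 v5)) (split v1 v3 (split v1 v5 (split v5 v6
  (clashʳ v8 v7 v2 v5) (clashˡ v1 v4 v6 v5)) (clashʳ v1 v4 v6 v5)) (clashˡ v3 v1 v0 v8)))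
  (split v1 v6 (clashˡ v1 v6 v4 v9) (clashˡ v6 v1 v4 v2))))) (clashʳ v6 v7 v9 v8))
  (clashʳ v7 v6 v9 v1)) (split v2 v4 (split v2 v8 (split v4 v8 (split v2 v3 (split v0 v1
  (split v3 v8 (clashˡ v0 v1 v3 v8) (split v3 v6 (split v3 v7 (clashʳ v4 v3 v9 v0)
  (clashˡ v2 v7 v3 v6)) (clashˡ v2 v4 v6 v3))) (split v3 v8 (clashˡ v0 v3 v8 v7)
  (clashʳ v0 v8 v3 v1))) (clashʳ v2 v4 v6 v3)) (clashˡ v1 v8 v4 v6)) (clashʳ v8 v2 v7 v0))
  (clashʳ v4 v2 v6 v1)))) (clashʳ v0 v4 v7 v8)) (clashˡ v1 v2 v9 v7)) (clashˡ v0 v7 v4 v9))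
  (split v1 v7 (split v7 v8 (split v0 v8 (split v2 v8 (split v4 v8 (split v0 v3 (split v2 v3
  (split v3 v8 (clashʳ v0 v3 v8 v7) (clashʳ v0 v8 v3 v1)) (clashʳ v0 v3 v8 v7)) (split v1 v3
  (split v3 v7 (split v1 v6 (split v4 v6 (split v2 v6 (clashˡ v3 v7 v2 v6) (clashʳ v7 v6 v9 v1))
  (clashˡ v1 v6 v4 v8)) (clashʳ v3 v7 v2 v6)) (clashˡ v7 v3 v2 v8)) (clashˡ v3 v1 v0 v8)))
  (clashˡ v1 v8 v4 v9)) (clashˡ v7 v0 v8 v2)) (clashˡ v7 v8 v0 v4)) (split v1 v8
  (clashˡ v1 v8 v4 v9) (split v0 v3 (clashˡ v8 v7 v0 v3) (split v1 v3 (split v3 v7 (split v6 v9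
  (split v6 v7 (split v1 v6 (clashʳ v1 v6 v4 v8) (clashʳ v3 v7 v2 v6)) (clashʳ v7 v6 v9 v1))
  (clashˡ v3 v7 v2 v6)) (clashʳ v7 v3 v2 v8)) (split v3 v8 (clashʳ v8 v7 v0 v3)
  (clashʳ v3 v1 v0 v8)))))) (clashʳ v1 v2 v9 v7))) (clashʳ v2 v1 v9 v0)) (clashʳ v0 v4 v9 v2))
  (clashˡ v0 v4 v9 v2)) (clashʳ v4 v0 v9 v1)) (split v2 v9 (split v1 v2 (split v0 v3 (split v0 v8
  (split v3 v8 (split v0 v7 (clashˡ v4 v9 v0 v7) (clashʳ v0 v3 v8 v7)) (clashʳ v0 v8 v3 v1))
  (split v0 v7 (clashˡ v4 v9 v0 v7) (split v7 v8 (split v2 v7 (split v7 v9 (split v4 v7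
  (clashʳ v7 v8 v0 v4) (clashʳ v4 v9 v0 v7)) (clashʳ v7 v8 v0 v4)) (split v2 v8
  (clashˡ v7 v2 v8 v0) (clashˡ v7 v8 v2 v3))) (clashˡ v8 v7 v0 v3)))) (split v1 v3 (split v0 v8
  (split v0 v7 (clashˡ v4 v9 v0 v7) (split v2 v7 (clashʳ v7 v0 v8 v2) (split v4 v7 (split v4 v6
  (split v2 v6 (clashʳ v4 v2 v6 v1) (split v6 v7 (clashˡ v6 v7 v9 v8) (clashʳ v7 v6 v9 v1)))
  (clashˡ v6 v7 v9 v8)) (clashʳ v4 v9 v0 v7)))) (split v3 v8 (clashʳ v3 v8 v0 v1) (split v0 v7
  (clashˡ v4 v9 v0 v7) (split v7 v8 (clashʳ v8 v3 v0 v7) (split v4 v7 (split v7 v9 (split v6 v9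
  (split v6 v7 (split v6 v8 (split v1 v6 (split v4 v6 (split v3 v9 (clashˡ v4 v3 v9 v0)
  (split v2 v6 (clashˡ v2 v8 v7 v3) (split v2 v7 (clashʳ v2 v7 v3 v6) (split v1 v5 (split v5 v6
  (clashʳ v8 v7 v2 v5) (clashˡ v1 v4 v6 v5)) (clashʳ v1 v4 v6 v5))))) (clashˡ v1 v6 v4 v9))
  (split v2 v3 (split v2 v4 (split v2 v8 (split v4 v8 (split v3 v7 (clashˡ v4 v3 v9 v0)
  (clashʳ v2 v7 v3 v6)) (clashʳ v1 v8 v4 v6)) (clashˡ v8 v2 v7 v0)) (clashˡ v6 v4 v2 v3))
  (split v2 v7 (clashˡ v8 v2 v7 v0) (clashˡ v6 v1 v4 v2)))) (clashʳ v6 v7 v9 v8))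
  (clashʳ v7 v6 v9 v1)) (split v2 v4 (split v2 v8 (split v4 v8 (split v3 v6 (split v3 v7
  (clashˡ v4 v3 v9 v0) (clashˡ v2 v7 v3 v6)) (clashˡ v2 v4 v6 v3)) (clashˡ v1 v8 v4 v6))
  (clashˡ v8 v2 v7 v0)) (clashʳ v4 v2 v6 v1))) (clashˡ v1 v2 v9 v7)) (clashʳ v4 v9 v0 v7))))))
  (split v0 v8 (clashˡ v3 v1 v0 v8) (split v3 v8 (split v0 v7 (clashˡ v4 v9 v0 v7) (split v7 v8
  (split v4 v7 (clashʳ v7 v8 v0 v4) (clashʳ v4 v9 v0 v7)) (clashʳ v8 v7 v0 v3)))
  (clashʳ v3 v1 v0 v8))))) (clashˡ v2 v1 v9 v0)) (clashˡ v1 v4 v9 v2))) (split v0 v9 (split v0 v4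
  (clashʳ v4 v1 v9 v0) (split v2 v9 (split v0 v2 (clashʳ v0 v2 v9 v4) (split v1 v2
  (clashʳ v2 v0 v9 v1) (split v0 v7 (split v7 v8 (split v1 v8 (split v0 v3 (split v3 v8
  (split v3 v7 (clashˡ v2 v3 v7 v8) (split v3 v9 (split v1 v7 (clashʳ v1 v7 v9 v2) (split v1 v3
  (clashˡ v0 v1 v3 v8) (split v1 v6 (clashˡ v2 v7 v3 v6) (split v4 v6 (clashˡ v4 v6 v1 v8)
  (clashʳ v7 v1 v9 v6))))) (clashˡ v4 v0 v9 v3))) (clashˡ v0 v7 v8 v3)) (clashʳ v0 v7 v8 v3))
  (clashˡ v4 v8 v1 v9)) (split v0 v8 (clashʳ v0 v8 v7 v4) (split v2 v8 (clashʳ v8 v0 v7 v2)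
  (split v4 v8 (clashˡ v4 v8 v1 v9) (split v0 v3 (split v3 v7 (clashʳ v2 v3 v7 v8) (split v3 v9
  (split v1 v7 (clashʳ v1 v7 v9 v2) (split v1 v3 (clashʳ v0 v1 v3 v8) (split v6 v9 (split v6 v7
  (clashʳ v7 v1 v9 v6) (split v1 v6 (clashˡ v2 v7 v3 v6) (clashʳ v4 v6 v1 v8)))
  (clashˡ v2 v7 v3 v6)))) (clashˡ v4 v0 v9 v3))) (split v2 v3 (clashˡ v8 v3 v0 v7) (split v0 v1
  (split v3 v8 (clashˡ v3 v8 v0 v1) (clashˡ v8 v3 v0 v7)) (split v7 v9 (clashʳ v1 v7 v9 v2)
  (split v3 v8 (clashʳ v4 v0 v9 v3) (clashʳ v3 v1 v0 v8)))))))))) (split v4 v7 (clashˡ v4 v7 v0 v9)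
  (split v0 v8 (clashˡ v7 v4 v0 v8) (split v7 v8 (split v6 v9 (split v6 v7 (clashʳ v7 v1 v9 v6)
  (split v6 v8 (clashʳ v6 v8 v9 v7) (split v0 v3 (split v2 v7 (split v4 v6 (split v1 v6
  (clashʳ v4 v1 v6 v2) (clashˡ v4 v6 v1 v9)) (split v3 v9 (split v0 v1 (split v1 v3
  (clashʳ v0 v1 v3 v8) (split v1 v5 (clashˡ v6 v4 v1 v5) (split v5 v6 (clashʳ v6 v4 v1 v5)
  (clashˡ v2 v7 v8 v5)))) (split v1 v5 (clashˡ v6 v4 v1 v5) (split v5 v6 (clashʳ v6 v4 v1 v5)
  (clashˡ v2 v7 v8 v5)))) (clashˡ v4 v0 v9 v3))) (split v2 v8 (clashˡ v7 v2 v8 v0)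
  (clashˡ v7 v8 v2 v3))) (split v3 v8 (split v3 v4 (clashʳ v4 v0 v9 v3) (split v1 v6 (split v2 v3
  (split v2 v7 (clashˡ v2 v7 v3 v6) (clashˡ v7 v2 v8 v0)) (split v2 v8 (clashˡ v7 v2 v8 v0)
  (clashˡ v4 v8 v1 v6))) (clashˡ v4 v6 v1 v9))) (clashʳ v8 v3 v0 v7))))) (clashˡ v7 v1 v9 v6))
  (clashʳ v7 v4 v0 v8))))))) (split v4 v6 (split v1 v6 (split v2 v6 (split v7 v9 (split v1 v7
  (clashˡ v1 v7 v9 v2) (clashˡ v7 v1 v9 v6)) (split v6 v7 (clashʳ v9 v6 v7 v1) (split v0 v8
  (split v7 v8 (split v6 v8 (clashˡ v9 v7 v6 v8) (split v0 v3 (split v3 v8 (split v2 v3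
  (clashʳ v2 v3 v6 v4) (split v3 v9 (split v2 v7 (split v0 v1 (split v1 v3 (clashˡ v0 v1 v3 v8)
  (split v1 v5 (split v5 v6 (clashʳ v1 v5 v6 v4) (clashˡ v2 v7 v8 v5)) (clashʳ v2 v7 v8 v5)))
  (split v1 v5 (split v5 v6 (clashʳ v1 v5 v6 v4) (clashˡ v2 v7 v8 v5)) (clashʳ v2 v7 v8 v5)))
  (clashˡ v3 v7 v2 v6)) (clashˡ v4 v0 v9 v3))) (clashˡ v0 v7 v8 v3)) (clashʳ v0 v7 v8 v3)))
  (clashʳ v0 v8 v7 v4)) (clashʳ v9 v7 v6 v8)))) (clashˡ v4 v1 v6 v2)) (clashˡ v4 v6 v1 v9))
  (split v7 v9 (split v1 v7 (clashˡ v1 v7 v9 v2) (split v6 v7 (clashʳ v7 v1 v9 v6) (split v7 v8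
  (split v0 v8 (clashˡ v7 v4 v0 v8) (split v6 v8 (clashʳ v6 v8 v9 v7) (split v2 v3
  (clashˡ v6 v4 v2 v3) (split v3 v6 (clashʳ v6 v4 v2 v3) (split v0 v3 (split v3 v9 (split v0 v1
  (split v1 v3 (clashʳ v0 v1 v3 v8) (split v1 v5 (clashˡ v6 v4 v1 v5) (split v5 v6
  (clashʳ v6 v4 v1 v5) (clashʳ v8 v5 v2 v7)))) (split v1 v5 (clashˡ v6 v4 v1 v5) (split v5 v6
  (clashʳ v6 v4 v1 v5) (clashʳ v8 v5 v2 v7)))) (clashˡ v4 v0 v9 v3)) (clashʳ v8 v3 v0 v7))))))
  (clashʳ v7 v4 v0 v8)))) (split v0 v8 (split v7 v8 (split v0 v3 (split v2 v3 (clashˡ v6 v4 v2 v3)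
  (split v3 v8 (split v3 v9 (split v2 v7 (split v0 v1 (split v1 v3 (clashˡ v0 v1 v3 v8)
  (split v1 v5 (clashˡ v6 v4 v1 v5) (clashʳ v2 v7 v8 v5))) (split v1 v5 (clashˡ v6 v4 v1 v5)
  (clashʳ v2 v7 v8 v5))) (clashʳ v3 v7 v2 v6)) (clashˡ v4 v0 v9 v3)) (clashˡ v0 v7 v8 v3)))
  (clashʳ v0 v7 v8 v3)) (clashʳ v0 v8 v7 v4)) (split v2 v7 (split v6 v8 (clashˡ v6 v8 v9 v7)
  (split v2 v3 (clashˡ v6 v4 v2 v3) (split v3 v6 (clashˡ v3 v6 v2 v7) (split v0 v3 (split v3 v9
  (split v0 v1 (split v1 v3 (clashʳ v0 v1 v3 v8) (split v1 v5 (clashˡ v6 v4 v1 v5) (split v5 v6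
  (clashʳ v6 v4 v1 v5) (clashˡ v8 v5 v2 v7)))) (split v1 v5 (clashˡ v6 v4 v1 v5) (split v5 v6
  (clashʳ v6 v4 v1 v5) (clashˡ v8 v5 v2 v7)))) (clashˡ v4 v0 v9 v3)) (clashˡ v8 v3 v0 v7)))))
  (clashˡ v8 v0 v7 v2))))))) (clashˡ v4 v1 v9 v0))) (split v0 v9 (split v0 v4 (split v2 v9
  (split v0 v2 (split v0 v3 (split v1 v3 (split v0 v8 (split v3 v8 (clashˡ v0 v1 v3 v8)
  (split v0 v7 (split v7 v8 (clashˡ v0 v7 v8 v3) (split v4 v7 (split v2 v7 (split v2 v8
  (split v3 v7 (split v1 v6 (clashˡ v4 v9 v1 v6) (split v4 v6 (split v2 v6 (clashˡ v2 v6 v3 v7)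
  (clashʳ v9 v1 v7 v6)) (clashʳ v4 v9 v1 v6))) (clashˡ v2 v8 v7 v3)) (clashʳ v8 v2 v7 v0))
  (split v4 v8 (split v4 v6 (split v2 v6 (split v6 v9 (clashʳ v2 v6 v3 v7) (split v1 v6
  (clashˡ v4 v8 v1 v6) (clashʳ v2 v6 v3 v7))) (split v6 v7 (split v6 v8 (split v1 v5
  (clashˡ v8 v7 v2 v5) (split v5 v6 (clashʳ v8 v7 v2 v5) (clashʳ v6 v5 v1 v4)))
  (clashʳ v6 v7 v9 v8)) (clashˡ v7 v6 v9 v1))) (clashʳ v4 v8 v1 v6)) (clashʳ v4 v9 v1 v8)))
  (clashˡ v0 v7 v4 v9))) (split v2 v8 (split v1 v6 (clashˡ v4 v9 v1 v6) (split v4 v6 (split v2 v6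
  (clashʳ v2 v6 v3 v7) (clashˡ v7 v6 v9 v1)) (clashʳ v4 v9 v1 v6))) (clashˡ v7 v8 v2 v3))))
  (clashʳ v0 v1 v3 v8)) (split v0 v8 (split v3 v8 (split v0 v7 (split v7 v8 (split v4 v7
  (clashˡ v0 v4 v7 v8) (clashˡ v0 v7 v4 v9)) (clashˡ v0 v3 v8 v7)) (clashʳ v0 v3 v8 v7))
  (clashˡ v0 v8 v3 v1)) (clashʳ v4 v9 v1 v8))) (split v0 v8 (split v0 v7 (split v7 v8
  (clashʳ v0 v7 v8 v3) (split v2 v7 (split v2 v8 (clashʳ v2 v8 v7 v3) (clashʳ v8 v2 v7 v0))
  (split v4 v7 (split v4 v8 (split v4 v6 (split v2 v6 (clashˡ v3 v7 v2 v6) (split v6 v7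
  (split v6 v8 (split v1 v5 (clashˡ v8 v7 v2 v5) (split v5 v6 (clashʳ v8 v7 v2 v5)
  (clashʳ v6 v5 v1 v4))) (clashʳ v6 v7 v9 v8)) (clashˡ v7 v6 v9 v1))) (clashʳ v4 v8 v1 v6))
  (clashʳ v4 v9 v1 v8)) (clashˡ v0 v7 v4 v9)))) (split v2 v8 (split v3 v7 (split v1 v6
  (clashˡ v4 v9 v1 v6) (split v4 v6 (split v2 v6 (clashˡ v3 v7 v2 v6) (clashˡ v7 v6 v9 v1))
  (clashʳ v4 v9 v1 v6))) (clashˡ v7 v3 v2 v8)) (clashˡ v7 v0 v8 v2))) (clashʳ v4 v9 v1 v8)))
  (clashʳ v0 v4 v9 v2)) (clashˡ v0 v4 v9 v2)) (clashˡ v4 v0 v9 v1)) (split v2 v9 (split v0 v7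
  (clashˡ v4 v9 v0 v7) (split v4 v7 (split v0 v8 (split v2 v7 (clashʳ v7 v0 v8 v2) (split v1 v8
  (clashˡ v4 v9 v1 v8) (split v0 v3 (split v1 v3 (split v4 v6 (split v2 v6 (split v6 v9
  (clashʳ v2 v6 v3 v7) (split v1 v6 (clashˡ v4 v8 v1 v6) (clashʳ v2 v6 v3 v7))) (split v6 v7
  (clashˡ v6 v7 v9 v8) (clashˡ v7 v6 v9 v1))) (clashʳ v4 v8 v1 v6)) (split v3 v8
  (clashʳ v0 v3 v8 v7) (clashˡ v0 v8 v3 v1))) (split v4 v6 (split v1 v6 (clashˡ v4 v8 v1 v6)
  (split v2 v6 (clashˡ v4 v2 v6 v1) (split v6 v7 (clashˡ v6 v7 v9 v8) (clashˡ v7 v6 v9 v1))))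
  (clashʳ v4 v8 v1 v6))))) (split v7 v8 (clashʳ v7 v8 v0 v4) (split v0 v3 (clashˡ v8 v7 v0 v3)
  (split v3 v8 (clashʳ v8 v7 v0 v3) (split v1 v6 (clashˡ v4 v9 v1 v6) (split v4 v6 (split v7 v9
  (split v4 v8 (split v3 v9 (clashˡ v4 v3 v9 v0) (split v2 v7 (split v2 v8 (clashˡ v2 v8 v7 v3)
  (clashˡ v8 v2 v7 v0)) (split v2 v6 (clashˡ v4 v2 v6 v1) (split v6 v7 (split v6 v8 (split v0 v1
  (split v1 v5 (clashˡ v8 v7 v2 v5) (split v5 v6 (clashʳ v8 v7 v2 v5) (clashʳ v6 v5 v1 v4)))
  (split v1 v3 (split v1 v5 (clashˡ v8 v7 v2 v5) (split v5 v6 (clashʳ v8 v7 v2 v5)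
  (clashʳ v6 v5 v1 v4))) (clashʳ v3 v1 v0 v8))) (clashʳ v6 v7 v9 v8)) (clashˡ v7 v6 v9 v1)))))
  (clashʳ v4 v6 v1 v8)) (split v2 v8 (split v1 v7 (split v6 v9 (clashʳ v9 v1 v7 v6) (split v1 v3
  (split v3 v7 (clashˡ v2 v6 v3 v7) (clashˡ v2 v8 v7 v3)) (clashʳ v3 v1 v0 v8)))
  (clashʳ v9 v7 v1 v2)) (clashˡ v8 v2 v7 v0))) (clashʳ v4 v9 v1 v6))))))) (clashʳ v4 v9 v0 v7)))
  (split v0 v2 (split v1 v2 (split v4 v6 (split v1 v6 (clashˡ v4 v9 v1 v6) (split v0 v7
  (clashˡ v4 v9 v0 v7) (split v4 v7 (split v7 v8 (split v0 v8 (split v2 v8 (clashˡ v4 v6 v1 v8)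
  (clashˡ v7 v0 v8 v2)) (clashʳ v7 v8 v0 v4)) (split v2 v3 (clashˡ v8 v7 v0 v3) (split v3 v6
  (split v3 v7 (split v0 v1 (split v7 v9 (split v3 v8 (clashˡ v3 v8 v0 v1) (split v6 v9
  (split v4 v8 (clashˡ v4 v3 v9 v0) (clashʳ v4 v6 v1 v8)) (split v4 v8 (clashˡ v4 v3 v9 v0)
  (clashʳ v4 v6 v1 v8)))) (clashˡ v9 v7 v1 v2)) (split v3 v8 (clashʳ v8 v7 v0 v3)
  (clashʳ v3 v1 v0 v8))) (clashʳ v3 v6 v2 v7)) (clashʳ v6 v3 v2 v4)))) (clashʳ v4 v9 v0 v7))))
  (clashʳ v4 v9 v1 v6)) (clashˡ v9 v0 v2 v1)) (clashʳ v9 v2 v0 v4))))) (split v1 v9 (split v0 v9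
  (split v2 v9 (split v0 v2 (clashˡ v0 v2 v9 v4) (split v1 v2 (clashʳ v2 v0 v9 v1) (split v4 v6
  (clashˡ v1 v9 v4 v6) (split v1 v6 (split v0 v7 (split v4 v7 (clashˡ v0 v9 v4 v7) (split v7 v8
  (split v2 v3 (split v3 v6 (clashˡ v2 v3 v6 v4) (split v3 v7 (clashˡ v2 v6 v3 v7) (split v0 v1
  (split v3 v8 (clashˡ v0 v1 v3 v8) (clashˡ v0 v7 v8 v3)) (split v7 v9 (clashʳ v1 v7 v9 v2)
  (split v3 v8 (split v6 v9 (split v4 v8 (clashˡ v1 v6 v4 v8) (clashʳ v9 v3 v4 v0)) (split v4 v8
  (clashˡ v1 v6 v4 v8) (clashʳ v9 v3 v4 v0))) (clashʳ v0 v8 v3 v1)))))) (clashʳ v0 v7 v8 v3))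
  (split v0 v8 (clashˡ v0 v8 v7 v4) (split v2 v8 (clashʳ v8 v0 v7 v2) (clashʳ v1 v6 v4 v8)))))
  (clashʳ v0 v9 v4 v7)) (clashʳ v1 v9 v4 v6))))) (split v0 v7 (split v4 v7 (clashˡ v0 v9 v4 v7)
  (split v0 v8 (split v7 v8 (split v0 v3 (split v3 v8 (split v1 v6 (split v4 v6
  (clashˡ v1 v9 v4 v6) (split v7 v9 (split v2 v8 (clashʳ v7 v2 v8 v0) (split v1 v7
  (clashˡ v1 v7 v9 v2) (split v6 v9 (split v1 v3 (clashˡ v0 v1 v3 v8) (split v3 v7
  (clashʳ v7 v8 v2 v3) (clashʳ v3 v6 v2 v7))) (clashˡ v7 v1 v9 v6)))) (split v4 v8
  (clashˡ v1 v6 v4 v8) (split v3 v9 (split v2 v7 (split v2 v6 (split v6 v7 (clashʳ v9 v6 v7 v1)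
  (split v6 v8 (clashˡ v9 v7 v6 v8) (split v0 v1 (split v1 v3 (clashˡ v0 v1 v3 v8) (split v1 v5
  (split v5 v6 (clashˡ v1 v5 v6 v4) (clashˡ v2 v7 v8 v5)) (clashʳ v2 v7 v8 v5))) (split v1 v5
  (split v5 v6 (clashˡ v1 v5 v6 v4) (clashˡ v2 v7 v8 v5)) (clashʳ v2 v7 v8 v5)))))
  (clashʳ v6 v2 v4 v1)) (split v2 v8 (clashʳ v7 v2 v8 v0) (clashʳ v7 v8 v2 v3)))
  (clashʳ v9 v3 v4 v0))))) (clashʳ v1 v9 v4 v6)) (clashˡ v0 v7 v8 v3)) (clashʳ v0 v7 v8 v3))
  (clashˡ v0 v8 v7 v4)) (split v2 v7 (split v1 v8 (split v0 v3 (split v4 v6 (clashˡ v1 v8 v4 v6)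
  (split v1 v6 (split v2 v6 (split v6 v7 (clashʳ v9 v6 v7 v1) (clashʳ v9 v7 v6 v8))
  (clashʳ v6 v2 v4 v1)) (clashʳ v1 v8 v4 v6))) (split v1 v3 (split v3 v8 (clashʳ v3 v8 v0 v1)
  (clashˡ v8 v3 v0 v7)) (split v4 v6 (clashˡ v1 v8 v4 v6) (split v2 v6 (split v6 v7
  (clashʳ v9 v6 v7 v1) (clashʳ v9 v7 v6 v8)) (split v6 v9 (split v1 v6 (clashˡ v3 v6 v2 v7)
  (clashʳ v1 v8 v4 v6)) (clashˡ v3 v6 v2 v7)))))) (clashʳ v1 v9 v4 v8)) (clashˡ v8 v0 v7 v2))))
  (clashʳ v0 v9 v4 v7))) (split v0 v4 (clashʳ v9 v0 v4 v1) (split v2 v9 (clashʳ v9 v4 v0 v2)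
  (split v0 v2 (clashˡ v9 v4 v0 v2) (split v0 v3 (split v0 v8 (clashˡ v1 v9 v4 v8) (split v0 v7
  (split v2 v8 (clashʳ v8 v0 v7 v2) (split v3 v7 (clashʳ v2 v3 v7 v8) (split v1 v6 (split v4 v6
  (clashˡ v1 v9 v4 v6) (split v2 v6 (clashʳ v9 v6 v7 v1) (clashʳ v2 v7 v3 v6)))
  (clashʳ v1 v9 v4 v6)))) (split v7 v8 (split v2 v7 (split v4 v7 (clashʳ v4 v7 v0 v9) (split v4 v8
  (clashˡ v1 v9 v4 v8) (split v4 v6 (clashˡ v1 v8 v4 v6) (split v2 v6 (split v6 v7
  (clashʳ v9 v6 v7 v1) (split v6 v8 (clashˡ v9 v7 v6 v8) (split v1 v5 (split v5 v6
  (clashˡ v1 v5 v6 v4) (clashˡ v2 v7 v8 v5)) (clashʳ v2 v7 v8 v5)))) (clashʳ v2 v7 v3 v6)))))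
  (split v2 v8 (clashˡ v7 v2 v8 v0) (clashˡ v7 v8 v2 v3))) (clashˡ v8 v7 v0 v3)))) (split v1 v3
  (split v0 v8 (clashˡ v1 v9 v4 v8) (split v3 v8 (clashʳ v3 v8 v0 v1) (split v0 v7
  (clashˡ v8 v3 v0 v7) (split v7 v8 (clashʳ v8 v3 v0 v7) (split v4 v7 (clashʳ v4 v7 v0 v9)
  (clashʳ v7 v4 v0 v8)))))) (split v0 v8 (clashˡ v3 v1 v0 v8) (split v3 v8 (split v0 v7
  (split v2 v8 (clashʳ v2 v8 v7 v3) (split v1 v6 (split v4 v6 (clashˡ v1 v9 v4 v6) (split v2 v6
  (clashʳ v9 v6 v7 v1) (clashˡ v3 v6 v2 v7))) (clashʳ v1 v9 v4 v6))) (split v7 v8 (split v4 v7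
  (clashʳ v4 v7 v0 v9) (split v2 v7 (split v4 v8 (clashˡ v1 v9 v4 v8) (split v4 v6
  (clashˡ v1 v8 v4 v6) (split v2 v6 (split v6 v7 (clashʳ v9 v6 v7 v1) (split v6 v8
  (clashˡ v9 v7 v6 v8) (split v1 v5 (split v5 v6 (clashˡ v1 v5 v6 v4) (clashˡ v2 v7 v8 v5))
  (clashʳ v2 v7 v8 v5)))) (split v6 v9 (split v1 v6 (clashˡ v3 v6 v2 v7) (clashʳ v1 v8 v4 v6))
  (clashˡ v3 v6 v2 v7))))) (split v2 v8 (clashˡ v7 v2 v8 v0) (split v3 v7 (clashʳ v7 v8 v2 v3)
  (split v1 v6 (split v4 v6 (clashˡ v1 v9 v4 v6) (split v2 v6 (clashˡ v7 v1 v9 v6)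
  (clashʳ v3 v6 v2 v7))) (clashʳ v1 v9 v4 v6)))))) (clashʳ v8 v7 v0 v3)))
  (clashʳ v3 v1 v0 v8))))))))) (split v1 v4 (split v0 v9 (clashʳ v9 v1 v4 v0) (split v0 v4
  (split v2 v9 (split v4 v6 (split v7 v9 (split v0 v8 (split v2 v7 (clashʳ v7 v0 v8 v2)
  (split v6 v8 (split v2 v3 (split v3 v6 (split v0 v3 (clashʳ v0 v3 v8 v7) (split v3 v9
  (clashʳ v9 v0 v4 v3) (split v0 v1 (split v1 v5 (split v5 v6 (clashʳ v2 v5 v8 v7)
  (clashˡ v1 v4 v6 v5)) (clashʳ v1 v4 v6 v5)) (split v1 v3 (split v1 v5 (split v5 v6
  (clashʳ v2 v5 v8 v7) (clashˡ v1 v4 v6 v5)) (clashʳ v1 v4 v6 v5)) (clashˡ v3 v1 v0 v8)))))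
  (clashʳ v2 v6 v3 v7)) (clashʳ v2 v4 v6 v3)) (clashʳ v9 v8 v6 v7))) (split v7 v8
  (clashˡ v7 v8 v0 v4) (split v0 v3 (clashˡ v8 v7 v0 v3) (split v2 v3 (split v3 v8
  (clashʳ v8 v7 v0 v3) (split v3 v9 (clashʳ v9 v0 v4 v3) (split v2 v7 (clashˡ v2 v7 v3 v6)
  (split v0 v1 (split v1 v5 (clashˡ v8 v7 v2 v5) (clashʳ v1 v4 v6 v5)) (split v1 v3 (split v1 v5
  (clashˡ v8 v7 v2 v5) (clashʳ v1 v4 v6 v5)) (clashʳ v3 v1 v0 v8)))))) (clashʳ v2 v4 v6 v3)))))
  (split v1 v7 (split v6 v7 (split v7 v8 (clashˡ v0 v4 v7 v8) (split v0 v8 (split v6 v8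
  (split v2 v3 (split v3 v6 (split v0 v3 (clashˡ v0 v3 v8 v7) (split v3 v9 (clashʳ v9 v0 v4 v3)
  (split v0 v1 (split v1 v5 (split v5 v6 (clashˡ v2 v5 v8 v7) (clashˡ v1 v4 v6 v5))
  (clashʳ v1 v4 v6 v5)) (split v1 v3 (split v1 v5 (split v5 v6 (clashˡ v2 v5 v8 v7)
  (clashˡ v1 v4 v6 v5)) (clashʳ v1 v4 v6 v5)) (clashˡ v3 v1 v0 v8))))) (clashˡ v2 v4 v6 v3))
  (clashʳ v2 v4 v6 v3)) (clashˡ v9 v8 v6 v7)) (clashʳ v0 v4 v7 v8))) (clashˡ v9 v1 v7 v6))
  (clashʳ v9 v7 v1 v2))) (split v1 v6 (clashʳ v1 v6 v4 v9) (split v2 v6 (clashʳ v6 v1 v4 v2)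
  (split v7 v9 (split v6 v7 (split v0 v8 (clashˡ v6 v7 v9 v8) (split v7 v8 (clashˡ v7 v8 v0 v4)
  (split v6 v8 (split v0 v3 (clashˡ v8 v7 v0 v3) (split v3 v8 (clashʳ v8 v7 v0 v3) (split v2 v3
  (split v3 v9 (clashʳ v9 v0 v4 v3) (split v2 v7 (clashʳ v2 v7 v3 v6) (split v0 v1 (split v1 v5
  (clashˡ v8 v7 v2 v5) (split v5 v6 (clashʳ v8 v7 v2 v5) (clashˡ v6 v5 v1 v4))) (split v1 v3
  (split v1 v5 (clashˡ v8 v7 v2 v5) (split v5 v6 (clashʳ v8 v7 v2 v5) (clashˡ v6 v5 v1 v4)))
  (clashʳ v3 v1 v0 v8))))) (clashˡ v6 v3 v2 v4)))) (clashʳ v6 v7 v9 v8)))) (clashˡ v7 v6 v9 v1))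
  (split v1 v7 (clashʳ v9 v1 v7 v6) (clashʳ v9 v7 v1 v2)))))) (split v0 v2 (split v1 v2
  (split v0 v7 (split v4 v7 (split v0 v8 (split v7 v8 (clashˡ v0 v4 v7 v8) (split v6 v9
  (clashʳ v9 v1 v7 v6) (split v6 v7 (split v6 v8 (split v0 v3 (split v3 v8 (clashˡ v0 v3 v8 v7)
  (split v3 v4 (split v1 v6 (clashʳ v1 v6 v4 v9) (split v2 v3 (split v2 v8 (clashʳ v1 v8 v4 v6)
  (clashʳ v8 v2 v7 v0)) (split v2 v7 (clashʳ v8 v2 v7 v0) (clashʳ v3 v7 v2 v6))))
  (clashˡ v9 v0 v4 v3))) (split v2 v7 (split v2 v8 (clashʳ v2 v8 v7 v3) (clashʳ v8 v2 v7 v0))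
  (split v4 v6 (split v3 v9 (clashʳ v9 v0 v4 v3) (split v0 v1 (split v1 v5 (split v5 v6
  (clashʳ v8 v7 v2 v5) (clashˡ v1 v4 v6 v5)) (clashʳ v1 v4 v6 v5)) (split v1 v3 (split v1 v5
  (split v5 v6 (clashʳ v8 v7 v2 v5) (clashˡ v1 v4 v6 v5)) (clashʳ v1 v4 v6 v5))
  (clashˡ v3 v1 v0 v8)))) (split v1 v6 (clashʳ v1 v6 v4 v9) (clashˡ v6 v1 v4 v2)))))
  (clashˡ v9 v8 v6 v7)) (clashˡ v9 v1 v7 v6)))) (clashʳ v0 v4 v7 v8)) (clashʳ v0 v7 v4 v9))
  (split v7 v8 (split v0 v8 (split v2 v8 (split v4 v8 (split v0 v3 (split v2 v3 (split v0 v1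
  (split v7 v9 (split v3 v8 (clashˡ v0 v1 v3 v8) (clashˡ v9 v0 v4 v3)) (clashˡ v9 v7 v1 v2))
  (split v3 v8 (clashʳ v0 v3 v8 v7) (clashʳ v0 v8 v3 v1))) (clashʳ v0 v3 v8 v7)) (split v3 v7
  (split v3 v9 (clashʳ v9 v0 v4 v3) (split v1 v7 (split v1 v3 (split v6 v9 (clashʳ v3 v7 v2 v6)
  (split v6 v7 (split v1 v6 (clashˡ v1 v6 v4 v8) (clashʳ v3 v7 v2 v6)) (clashˡ v9 v1 v7 v6)))
  (clashˡ v3 v1 v0 v8)) (clashˡ v9 v7 v1 v2))) (clashˡ v7 v3 v2 v8))) (clashʳ v1 v8 v4 v9))
  (clashˡ v7 v0 v8 v2)) (clashˡ v7 v8 v0 v4)) (split v1 v8 (clashʳ v1 v8 v4 v9) (split v0 v3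
  (clashˡ v8 v7 v0 v3) (split v3 v8 (clashʳ v8 v7 v0 v3) (split v3 v7 (split v3 v9
  (clashʳ v9 v0 v4 v3) (split v1 v7 (split v1 v3 (split v1 v6 (split v4 v6 (clashˡ v9 v1 v7 v6)
  (clashʳ v1 v6 v4 v8)) (clashʳ v3 v7 v2 v6)) (clashʳ v3 v1 v0 v8)) (clashˡ v9 v7 v1 v2)))
  (clashʳ v7 v3 v2 v8))))))) (clashˡ v9 v0 v2 v1)) (clashˡ v9 v2 v0 v4))) (clashˡ v9 v1 v4 v0)))
  (split v0 v9 (split v2 v9 (clashʳ v9 v4 v1 v2) (split v1 v2 (clashʳ v9 v1 v2 v0) (split v0 v3
  (split v1 v3 (split v0 v8 (split v3 v8 (clashˡ v0 v1 v3 v8) (split v0 v7 (split v7 v8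
  (clashˡ v0 v7 v8 v3) (split v4 v7 (clashˡ v0 v9 v4 v7) (clashˡ v0 v8 v7 v4)))
  (clashʳ v0 v9 v4 v7))) (clashʳ v0 v1 v3 v8)) (split v0 v8 (split v3 v8 (split v0 v7 (split v7 v8
  (split v4 v7 (clashˡ v0 v9 v4 v7) (split v7 v9 (clashʳ v9 v2 v1 v7) (split v6 v9 (split v2 v4
  (clashˡ v6 v2 v4 v1) (split v2 v8 (clashʳ v7 v2 v8 v0) (split v4 v8 (clashʳ v4 v8 v1 v6)
  (split v3 v6 (clashʳ v6 v4 v2 v3) (split v3 v7 (clashʳ v3 v7 v2 v6) (clashʳ v9 v3 v4 v0))))))
  (split v6 v7 (clashˡ v9 v6 v7 v1) (split v6 v8 (clashˡ v9 v7 v6 v8) (split v1 v6 (split v2 v3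
  (split v2 v7 (clashʳ v4 v1 v6 v2) (clashʳ v7 v2 v8 v0)) (split v2 v4 (clashʳ v2 v4 v6 v3)
  (split v2 v8 (clashʳ v7 v2 v8 v0) (split v4 v8 (clashˡ v4 v8 v1 v6) (split v3 v7
  (clashˡ v3 v7 v2 v6) (clashʳ v9 v3 v4 v0)))))) (split v4 v6 (clashʳ v4 v6 v1 v9) (split v3 v9
  (split v2 v6 (split v2 v7 (split v1 v5 (clashˡ v6 v4 v1 v5) (split v5 v6 (clashʳ v6 v4 v1 v5)
  (clashˡ v2 v7 v8 v5))) (clashˡ v3 v7 v2 v6)) (clashʳ v7 v8 v2 v3)) (clashʳ v9 v3 v4 v0)))))))))
  (clashˡ v0 v3 v8 v7)) (clashʳ v0 v9 v4 v7)) (clashˡ v0 v8 v3 v1)) (split v0 v7 (split v2 v7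
  (split v4 v7 (clashˡ v0 v9 v4 v7) (split v4 v6 (clashʳ v9 v7 v6 v8) (split v2 v6 (split v6 v7
  (clashˡ v9 v6 v7 v1) (clashʳ v9 v7 v6 v8)) (clashˡ v6 v2 v4 v1)))) (clashˡ v8 v0 v7 v2))
  (clashʳ v0 v9 v4 v7)))) (split v0 v8 (split v0 v7 (split v7 v8 (clashʳ v0 v7 v8 v3) (split v2 v7
  (split v2 v8 (clashʳ v2 v8 v7 v3) (clashʳ v8 v2 v7 v0)) (split v7 v9 (clashˡ v0 v8 v7 v4)
  (split v4 v7 (clashˡ v0 v9 v4 v7) (clashˡ v0 v8 v7 v4))))) (clashʳ v0 v9 v4 v7)) (split v3 v8
  (clashˡ v3 v8 v0 v1) (split v0 v7 (clashˡ v8 v3 v0 v7) (clashʳ v0 v9 v4 v7))))))) (split v0 v4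
  (clashˡ v9 v0 v4 v1) (split v2 v9 (clashʳ v9 v4 v0 v2) (split v0 v2 (clashˡ v9 v4 v0 v2)
  (split v1 v2 (clashˡ v9 v1 v2 v0) (split v0 v7 (split v1 v7 (clashˡ v9 v2 v1 v7) (split v7 v8
  (split v1 v8 (split v0 v3 (split v1 v3 (split v3 v8 (clashˡ v0 v1 v3 v8) (clashˡ v0 v7 v8 v3))
  (split v3 v7 (clashˡ v2 v3 v7 v8) (split v6 v9 (clashʳ v2 v7 v3 v6) (split v6 v7
  (clashˡ v9 v6 v7 v1) (split v1 v6 (clashˡ v2 v7 v3 v6) (clashˡ v4 v6 v1 v8))))))
  (clashʳ v0 v7 v8 v3)) (clashʳ v4 v8 v1 v9)) (split v0 v8 (clashʳ v0 v8 v7 v4) (split v2 v8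
  (clashʳ v8 v0 v7 v2) (split v4 v8 (clashʳ v4 v8 v1 v9) (split v0 v3 (split v1 v3
  (clashʳ v0 v1 v3 v8) (split v3 v7 (clashʳ v2 v3 v7 v8) (split v1 v6 (clashˡ v2 v7 v3 v6)
  (split v4 v6 (clashʳ v4 v6 v1 v8) (split v2 v6 (clashˡ v9 v6 v7 v1) (clashʳ v2 v7 v3 v6))))))
  (split v2 v3 (clashˡ v8 v3 v0 v7) (split v3 v8 (clashˡ v3 v8 v0 v1) (clashˡ v8 v3 v0 v7)))))))))
  (split v4 v7 (clashʳ v4 v7 v0 v9) (split v7 v9 (clashʳ v9 v2 v1 v7) (split v0 v8
  (clashˡ v7 v4 v0 v8) (split v7 v8 (split v6 v9 (split v2 v4 (clashˡ v6 v2 v4 v1) (split v2 v8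
  (clashˡ v7 v2 v8 v0) (split v4 v8 (clashʳ v4 v8 v1 v6) (split v2 v3 (clashˡ v6 v4 v2 v3)
  (split v0 v1 (split v3 v8 (clashˡ v3 v8 v0 v1) (clashʳ v8 v3 v0 v7)) (split v3 v8 (split v3 v6
  (clashʳ v6 v4 v2 v3) (split v3 v7 (clashʳ v3 v7 v2 v6) (clashˡ v9 v3 v4 v0)))
  (clashʳ v3 v1 v0 v8))))))) (split v6 v7 (clashˡ v9 v6 v7 v1) (split v6 v8 (clashˡ v9 v7 v6 v8)
  (split v0 v3 (split v2 v7 (split v4 v6 (split v1 v6 (clashʳ v4 v1 v6 v2) (clashʳ v4 v6 v1 v9))
  (split v0 v1 (split v1 v3 (clashʳ v0 v1 v3 v8) (split v1 v5 (clashˡ v6 v4 v1 v5) (split v5 v6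
  (clashʳ v6 v4 v1 v5) (clashˡ v2 v7 v8 v5)))) (split v1 v5 (clashˡ v6 v4 v1 v5) (split v5 v6
  (clashʳ v6 v4 v1 v5) (clashˡ v2 v7 v8 v5))))) (split v2 v8 (clashˡ v7 v2 v8 v0)
  (clashˡ v7 v8 v2 v3))) (split v3 v8 (split v1 v6 (split v2 v3 (split v2 v7 (clashʳ v4 v1 v6 v2)
  (clashˡ v7 v2 v8 v0)) (split v0 v1 (clashˡ v3 v8 v0 v1) (split v2 v4 (clashʳ v2 v4 v6 v3)
  (split v2 v8 (clashˡ v7 v2 v8 v0) (split v4 v8 (clashˡ v4 v8 v1 v6) (split v3 v7
  (clashˡ v3 v7 v2 v6) (clashˡ v9 v3 v4 v0))))))) (split v4 v6 (clashʳ v4 v6 v1 v9) (split v0 v1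
  (clashˡ v3 v8 v0 v1) (split v3 v9 (split v2 v6 (split v2 v7 (split v1 v5 (clashˡ v6 v4 v1 v5)
  (split v5 v6 (clashʳ v6 v4 v1 v5) (clashˡ v2 v7 v8 v5))) (clashˡ v3 v7 v2 v6))
  (clashʳ v7 v8 v2 v3)) (clashˡ v9 v3 v4 v0))))) (clashʳ v8 v3 v0 v7))))))
  (clashʳ v7 v4 v0 v8)))))))))))))

theorem1p13 : ∃ λ (F : ThreeGraph) → Colorable Q5+2 F × ¬ Colorable Q3'- F
theorem1p13 =
  F₀ , F₀-Q5-colorable ,
  refutation-sound Q3'-outerSeparated F₀-refutation (from-yes (refutes? F₀ [] F₀-refutation))
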